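{- Let $G$ and $H$ be finite groups and let $a\ge 2$ be an integer. Then $$N(a, G \times H) \ge N(a, G)\, N(a, H).$$
   Context: For a finite group $K$ and integer $a\ge 2$, $G(a,K)$ is the undirected multigraph on vertex set $K$ with an edge between $x$ and $y$ whenever $x^a=y$ (an additional edge if also $y^a=x$; loops allowed), and $N(a,K)$ is its number of connected components, equivalently the number of cycles of the map $x\mapsto x^a$ on $K$. -}

module Defs where

open import Data.Nat using (ℕ; zero; suc)
open import Data.Fin using (Fin)
open import Data.Product using (_×_; _,_; Σ; ∃)
open import Function.Bundles using (_↔_; _⇔_)
open import Relation.Binary.PropositionalEquality using (_≡_)
open import Relation.Binary.Construct.Closure.Equivalence using (EqClosure)
open import Algebra.Structures using (IsGroup)

record FiniteGroup : Set₁ where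
  field
    Carrier : Set
    _∙_     : Carrier → Carrier → Carrier
    ε       : Carrier
    _⁻¹     : Carrier → Carrier
    isGroup : IsGroup _≡_ _∙_ ε _⁻¹
    size    : ℕ
    enum    : Carrier ↔ Fin size

pow : {A : Set} → (A → A → A) → A → A → ℕ → A
pow _∙_ e x zero    = e
pow _∙_ e x (suc k) = x ∙ pow _∙_ e x k

powMap : (G : FiniteGroup) → ℕ → FiniteGroup.Carrier G → FiniteGroup.Carrier G
powMap G a x = pow _∙_ ε x a
  where open FiniteGroup G

prodOp : (G H : FiniteGroup) →
         (FiniteGroup.Carrier G × FiniteGroup.Carrier H) →
         (FiniteGroup.Carrier G × FiniteGroup.Carrier H) →
         (FiniteGroup.Carrier G × FiniteGroup.Carrier H)
prodOp G H (g , h) (g' , h') = (FiniteGroup._∙_ G g g' , FiniteGroup._∙_ H h h')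

prodUnit : (G H : FiniteGroup) → FiniteGroup.Carrier G × FiniteGroup.Carrier H
prodUnit G H = (FiniteGroup.ε G , FiniteGroup.ε H)

powMapProd : (G H : FiniteGroup) → ℕ →
             FiniteGroup.Carrier G × FiniteGroup.Carrier H →
             FiniteGroup.Carrier G × FiniteGroup.Carrier H
powMapProd G H a x = pow (prodOp G H) (prodUnit G H) x a

Edge : {A : Set} → (A → A) → A → A → Set
Edge f x y = f x ≡ y

Connected : {A : Set} → (A → A) → A → A → Set
Connected f = EqClosure (Edge f)

-- "the graph of f has exactly k connected components":
-- there is a surjective labelling of vertices by Fin k whose fibres are
-- exactly the connected components.
HasComponents : {A : Set} → (A → A) → ℕ → Set
HasComponents {A} f k =
  Σ (A → Fin k) λ c →
    ((i : Fin k) → ∃ λ x → c x ≡ i) ×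
    ((x y : A) → (c x ≡ c y) ⇔ Connected f x y)

module Submission where

-- The power map of G × H acts componentwise, so each projection carries a
-- connected component of G(a, G × H) into a single component of G(a, G),
-- resp. G(a, H).  Hence choosing one vertex in each component of G(a, G)
-- and of G(a, H) gives N(a, G) N(a, H) pairs lying in pairwise distinct
-- components of G(a, G × H).

open import Defs
open import Data.Nat using (ℕ; _≤_; _*_; zero; suc)
open import Data.Fin using (Fin; remQuot)
open import Data.Fin.Properties using (injective⇒≤; *↔×)
open import Data.Product using (_×_; _,_; proj₁; proj₂)
open import Function using (Injective; Injection; _∘_)
open import Function.Bundles using (Equivalence)
open import Function.Properties.Inverse using (↔⇒↣)
open import Relation.Binary.PropositionalEquality
open import Relation.Binary.Construct.Closure.Equivalence using (gmap)

Connected-semiconj : {A B : Set} {f : A → A} {g : B → B} (h : A → B) →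
                     (∀ x → g (h x) ≡ h (f x)) →
                     ∀ {x y} → Connected f x y → Connected g (h x) (h y)
Connected-semiconj h comm = gmap h λ {x} fx≡y → trans (comm x) (cong h fx≡y)

module Components {A : Set} {f : A → A} {k : ℕ} (hc : HasComponents f k) where

  label : A → Fin k
  label = proj₁ hc

  representative : Fin k → A
  representative i = proj₁ (proj₁ (proj₂ hc) i)

  label-representative : ∀ i → label (representative i) ≡ i
  label-representative i = proj₂ (proj₁ (proj₂ hc) i)

  sameLabel⇒Connected : ∀ {x y} → label x ≡ label y → Connected f x y
  sameLabel⇒Connected {x} {y} = Equivalence.to (proj₂ (proj₂ hc) x y)

  Connected⇒sameLabel : ∀ {x y} → Connected f x y → label x ≡ label y
  Connected⇒sameLabel {x} {y} = Equivalence.from (proj₂ (proj₂ hc) x y)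

  Connected-representative⇒≡ : ∀ {i j} →
    Connected f (representative i) (representative j) → i ≡ j
  Connected-representative⇒≡ {i} {j} c = begin
    i                         ≡⟨ sym (label-representative i) ⟩
    label (representative i)  ≡⟨ Connected⇒sameLabel c ⟩
    label (representative j)  ≡⟨ label-representative j ⟩
    j                         ∎
    where open ≡-Reasoning

HasComponents-×-≤ : {A B : Set} {f : A → A} {g : B → B}
                    {F : A × B → A × B} {m n k : ℕ} →
                    (∀ p → proj₁ (F p) ≡ f (proj₁ p)) →
                    (∀ p → proj₂ (F p) ≡ g (proj₂ p)) →
                    HasComponents f m → HasComponents g n →
                    HasComponents F k → m * n ≤ k
HasComponents-×-≤ {m = m} {n} {k} F₁ F₂ hf hg hF =
  injective⇒≤ {f = pairLabel ∘ remQuot n}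
    (Injection.injective (↔⇒↣ (*↔× {m} {n})) ∘ pairLabel-injective)
  where
  module Cf = Components hf
  module Cg = Components hg
  module CF = Components hF

  pairLabel : Fin m × Fin n → Fin k
  pairLabel (i , j) = CF.label (Cf.representative i , Cg.representative j)

  pairLabel-injective : Injective _≡_ _≡_ pairLabel
  pairLabel-injective {i , j} {i′ , j′} same =
    cong₂ _,_ (Cf.Connected-representative⇒≡ (Connected-semiconj proj₁ (sym ∘ F₁) c))
              (Cg.Connected-representative⇒≡ (Connected-semiconj proj₂ (sym ∘ F₂) c))
    where c = CF.sameLabel⇒Connected same

module _ (G H : FiniteGroup) where
  private
    module G = FiniteGroup G
    module H = FiniteGroup H

  pow-prodOp : ∀ x y k → pow (prodOp G H) (prodUnit G H) (x , y) k
                         ≡ (pow G._∙_ G.ε x k , pow H._∙_ H.ε y k)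
  pow-prodOp x y zero    = refl
  pow-prodOp x y (suc k) rewrite pow-prodOp x y k = refl

  proj₁-powMapProd : ∀ a p → proj₁ (powMapProd G H a p) ≡ powMap G a (proj₁ p)
  proj₁-powMapProd a (x , y) = cong proj₁ (pow-prodOp x y a)

  proj₂-powMapProd : ∀ a p → proj₂ (powMapProd G H a p) ≡ powMap H a (proj₂ p)
  proj₂-powMapProd a (x , y) = cong proj₂ (pow-prodOp x y a)

-- The bound holds for every exponent.
theorem2p4 : (G H : FiniteGroup) (a : ℕ) → 2 ≤ a →
             (nG nH nGH : ℕ) →
             HasComponents (powMap G a) nG →
             HasComponents (powMap H a) nH →
             HasComponents (powMapProd G H a) nGH →
             nG * nH ≤ nGH
theorem2p4 G H a _ _ _ _ =
  HasComponents-×-≤ (proj₁-powMapProd G H a) (proj₂-powMapProd G H a)
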